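{- Let $G=(V,E)$ be an undirected unweighted graph with $n$ vertices, let $k$ be a positive integer, and let $H$ be a $k$-spanner of $G$ whose girth is at least $k+2$. Then there exists a total ordering $\sigma$ of $E$ such that the greedy algorithm run on input $\langle G,k\rangle$ with edge ordering $\sigma$ outputs exactly $H$.
   Context: All graphs are finite, undirected and unweighted. For a graph $G$ and vertices $u,v$, $\mathsf{dist}_G(u,v)$ is the length (number of edges) of a shortest $u$–$v$ path in $G$ ($\infty$ if none). A $k$-spanner of $G=(V,E)$ is a subgraph $H=(V,E')$ with $E'\subseteq E$ such that $\mathsf{dist}_H(u,v)\le k\cdot \mathsf{dist}_G(u,v)$ for all $u,v\in V$. The girth of a graph is the length of its shortest cycle ($\infty$ if the graph is acyclic). The greedy algorithm on input $\langle G,k\rangle$ with a total order $\sigma=(e_1<\dots<e_m)$ of $E$: start with $H=(V,\emptyset)$; for $i=1,\dots,m$, if $e_i=(u,v)$ satisfies $\mathsf{dist}_H(u,v)>k$, add $e_i$ to $H$; output the final $H$. -}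

module Defs where

open import Data.Nat using (ℕ; zero; suc; _≤_; _*_)
open import Data.Fin using (Fin) renaming (_<_ to _<ᶠ_)
open import Data.List using (List; []; _∷_; _++_; length)
open import Data.List.Relation.Unary.All using (All)
open import Data.List.Relation.Unary.Linked using (Linked)
open import Data.List.Relation.Unary.Unique.Propositional using (Unique)
open import Data.List.Membership.Propositional using (_∈_)
open import Data.Product using (Σ; ∃; _×_; _,_; proj₁; proj₂)
open import Data.Sum using (_⊎_)
open import Data.Empty using (⊥)
open import Relation.Nullary using (¬_)

-- An (undirected) edge on vertex set Fin n is stored as an ordered pair (u , v)
-- with u < v; the pair represents the unordered edge {u , v}.
Edge : ℕ → Set
Edge n = Fin n × Fin n

record Graph (n : ℕ) : Set where
  field
    edges      : List (Edge n)
    normalised : All (λ e → proj₁ e <ᶠ proj₂ e) edges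
    distinct   : Unique edges
open Graph public

Adj : {n : ℕ} → List (Edge n) → Fin n → Fin n → Set
Adj L u v = ((u , v) ∈ L) ⊎ ((v , u) ∈ L)

data Walk {n : ℕ} (L : List (Edge n)) : Fin n → Fin n → ℕ → Set where
  [] : ∀ {u} → Walk L u u zero
  _∷_ : ∀ {u w v m} → Adj L u w → Walk L w v m → Walk L u v (suc m)

DistLE : {n : ℕ} → List (Edge n) → Fin n → Fin n → ℕ → Set
DistLE L u v d = ∃ λ m → m ≤ d × Walk L u v m

-- H is a k-spanner of G: dist_H(u,v) ≤ k · dist_G(u,v) for all u, v
-- (when dist_G(u,v) = ∞ the condition is vacuous).
IsSpanner : {n : ℕ} → Graph n → List (Edge n) → ℕ → Set
IsSpanner {n} G H k =
  (u v : Fin n) (d : ℕ) → DistLE (edges G) u v d → DistLE H u v (k * d)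

IsSubgraph : {n : ℕ} → Graph n → List (Edge n) → Set
IsSubgraph G H = ∀ {e} → e ∈ H → e ∈ edges G

-- A cycle: a list of at least 3 distinct vertices, consecutive ones
-- adjacent, and the last adjacent to the first.  Its length is the
-- number of vertices (= number of edges).
IsCycle : {n : ℕ} → List (Edge n) → List (Fin n) → Set
IsCycle L [] = ⊥
IsCycle L (x ∷ xs) =
  Unique (x ∷ xs) × 3 ≤ length (x ∷ xs) × Linked (Adj L) ((x ∷ xs) ++ (x ∷ []))

GirthAtLeast : {n : ℕ} → List (Edge n) → ℕ → Set
GirthAtLeast L g = ∀ cs → IsCycle L cs → g ≤ length cs

-- Run of the greedy algorithm with parameter k:
-- Greedy k σ H out  means: processing the remaining edges σ in order,
-- starting from current edge set H, the algorithm ends with edge set out.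
data Greedy {n : ℕ} (k : ℕ) : List (Edge n) → List (Edge n) → List (Edge n) → Set where
  done : ∀ {H} → Greedy k [] H H
  add  : ∀ {u v σ H out} → ¬ DistLE H u v k →
         Greedy k σ ((u , v) ∷ H) out → Greedy k ((u , v) ∷ σ) H out
  skip : ∀ {u v σ H out} → DistLE H u v k →
         Greedy k σ H out → Greedy k ((u , v) ∷ σ) H out

module Submission where

-- Order the edges of G with those of H first.  Each edge uv of H is then
-- added: a u–v walk of length at most k through the edges of H added so far
-- shortens to a simple path which, closed up by uv, is a cycle of H of length
-- at most k + 1 < girth H.  Every remaining edge is skipped: by then all of H
-- has been added, and H is a k-spanner, so its endpoints are at distance at
-- most k.

open import Defs
open import Data.Nat using (ℕ; suc; _≤_; _+_; s≤s; z≤n)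
open import Data.Nat.Properties
  using (≤-refl; ≤-trans; ≤-pred; n≤1+n; <⇒≱; +-comm; *-identityʳ)
open import Data.Fin using (Fin) renaming (_<_ to _<ᶠ_)
open import Data.Fin.Properties using (<-irrefl; <-asym) renaming (_≟_ to _≟ᶠ_)
open import Data.List using (List; []; _∷_; _++_; _ʳ++_; reverse; length; filter)
open import Data.List.Properties using (partition-defn)
open import Data.List.Membership.Propositional using (_∈_; _∉_)
open import Data.List.Membership.Propositional.Properties using (∈-filter⁺; ∈-filter⁻)
import Data.List.Membership.DecPropositional as DecMembership
open import Data.List.Relation.Binary.Subset.Propositional using (_⊆_)
open import Data.List.Relation.Binary.Subset.Propositional.Properties using (∈-∷⁺ʳ)
open import Data.List.Relation.Binary.Permutation.Propositional using (_↭_; ↭-sym; ↭ₛ⇒↭)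
open import Data.List.Relation.Binary.Permutation.Setoid.Properties using (partition-↭)
open import Data.List.Relation.Unary.Any using (here; there)
open import Data.List.Relation.Unary.Any.Properties using (reverse⁺; reverse⁻)
open import Data.List.Relation.Unary.All as All using (All; []; _∷_)
open import Data.List.Relation.Unary.All.Properties using (¬Any⇒All¬)
open import Data.List.Relation.Unary.AllPairs using ([]; _∷_)
open import Data.List.Relation.Unary.Linked using (Linked; [-]; _∷_)
open import Data.List.Relation.Unary.Unique.Propositional using (Unique)
import Data.List.Relation.Unary.Unique.Propositional.Properties as Unique
open import Data.Product using (Σ; ∃; _×_; _,_; proj₁; proj₂)
open import Data.Product.Properties using (≡-dec)
open import Data.Empty using (⊥-elim)
import Data.Sum as Sum
open import Data.Sum using (inj₁; inj₂)
open import Function using (_∘_)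
open import Function.Bundles using (_⇔_; mk⇔)
open import Level using (Level)
open import Relation.Nullary using (¬_; Dec; yes; no)
open import Relation.Unary using (Pred; Decidable)
open import Relation.Unary.Properties using (∁?)
open import Relation.Binary.PropositionalEquality using (_≡_; _≢_; refl; sym; subst; setoid)

private
  variable
    a p : Level
    A : Set a
    n k m : ℕ
    L C : List (Edge n)
    u v w : Fin n
    vs : List (Fin n)

filter-++-filter-∁-↭ : {P : Pred A p} (P? : Decidable P) (xs : List A) →
                       filter P? xs ++ filter (∁? P?) xs ↭ xs
filter-++-filter-∁-↭ P? xs =
  ↭-sym (subst (λ parts → xs ↭ proj₁ parts ++ proj₂ parts) (partition-defn P? xs)
                (↭ₛ⇒↭ (partition-↭ (setoid _) P? xs)))

_≟ᵉ_ : (e f : Edge n) → Dec (e ≡ f)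
_≟ᵉ_ = ≡-dec _≟ᶠ_ _≟ᶠ_

Adj-mono : L ⊆ C → Adj L u v → Adj C u v
Adj-mono L⊆C = Sum.map L⊆C L⊆C

Walk-mono : L ⊆ C → Walk L u v m → Walk C u v m
Walk-mono L⊆C []          = []
Walk-mono L⊆C (uw ∷ walk) = Adj-mono L⊆C uw ∷ Walk-mono L⊆C walk

DistLE-mono : L ⊆ C → DistLE L u v m → DistLE C u v m
DistLE-mono L⊆C (m , m≤d , walk) = m , m≤d , Walk-mono L⊆C walk

data VertexWalk (L : List (Edge n)) : Fin n → Fin n → List (Fin n) → Set where
  []  : VertexWalk L u u (u ∷ [])
  _∷_ : Adj L u w → VertexWalk L w v vs → VertexWalk L u v (u ∷ vs)

VertexWalk-mono : L ⊆ C → VertexWalk L u v vs → VertexWalk C u v vs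
VertexWalk-mono L⊆C []          = []
VertexWalk-mono L⊆C (uw ∷ walk) = Adj-mono L⊆C uw ∷ VertexWalk-mono L⊆C walk

VertexWalk-nonempty : VertexWalk L u v vs → 1 ≤ length vs
VertexWalk-nonempty []      = s≤s z≤n
VertexWalk-nonempty (_ ∷ _) = s≤s z≤n

VertexWalk-suffix : VertexWalk L u v vs → Unique vs → w ∈ vs →
                    ∃ λ ws → VertexWalk L w v ws × Unique ws × length ws ≤ length vs
VertexWalk-suffix walk@[]      unique       (here refl) = _ , walk , unique , ≤-refl
VertexWalk-suffix walk@(_ ∷ _) unique       (here refl) = _ , walk , unique , ≤-refl
VertexWalk-suffix (_ ∷ walk)   (_ ∷ unique) (there w∈vs)
  with ws , suffix , unique′ , |ws|≤ ← VertexWalk-suffix walk unique w∈vs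
  = ws , suffix , unique′ , ≤-trans |ws|≤ (n≤1+n _)

Walk⇒simpleVertexWalk : Walk L u v m →
                        ∃ λ vs → VertexWalk L u v vs × Unique vs × length vs ≤ suc m
Walk⇒simpleVertexWalk []                  = _ , [] , [] ∷ [] , ≤-refl
Walk⇒simpleVertexWalk {u = u} (uw ∷ walk)
  with vs , path , unique , |vs|≤ ← Walk⇒simpleVertexWalk walk
  with DecMembership._∈?_ _≟ᶠ_ u vs
... | yes u∈vs with ws , suffix , unique′ , |ws|≤ ← VertexWalk-suffix path unique u∈vs
  = ws , suffix , unique′ , ≤-trans |ws|≤ (≤-trans |vs|≤ (n≤1+n _))
... | no u∉vs = u ∷ vs , uw ∷ path , ¬Any⇒All¬ vs u∉vs ∷ unique , s≤s |vs|≤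

VertexWalk-close : VertexWalk L u v vs → Adj L v w → Linked (Adj L) (vs ++ w ∷ [])
VertexWalk-close []                  vw = vw ∷ [-]
VertexWalk-close (uw ∷ walk@[])      vw = uw ∷ VertexWalk-close walk vw
VertexWalk-close (uw ∷ walk@(_ ∷ _)) vw = uw ∷ VertexWalk-close walk vw

VertexWalk-close-cycle : VertexWalk L u v vs → Unique vs → 3 ≤ length vs → Adj L v u →
                         IsCycle L vs
VertexWalk-close-cycle [] _ (s≤s ()) _
VertexWalk-close-cycle walk@(_ ∷ _) unique 3≤|vs| vu =
  unique , 3≤|vs| , VertexWalk-close walk vu

-- Normalisation (edges are stored as (u , v) with u < v) is what rules out
-- the closed walk u v u formed by (u , v) ∈ L together with (v , u) ∈ C.
girth≤1+detour : ∀ {g} → GirthAtLeast L g → All (λ e → proj₁ e <ᶠ proj₂ e) L →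
                 (u , v) ∈ L → C ⊆ L → (u , v) ∉ C → Walk C u v m → g ≤ suc m
girth≤1+detour {L = L} girth normalised uv∈L C⊆L uv∉C walk
  with Walk⇒simpleVertexWalk walk
... | _ , [] , _ , _ = ⊥-elim (<-irrefl refl (All.lookup normalised uv∈L))
... | _ , inj₁ uv∈C ∷ [] , _ , _ = ⊥-elim (uv∉C uv∈C)
... | _ , inj₂ vu∈C ∷ [] , _ , _ =
  ⊥-elim (<-asym (All.lookup normalised uv∈L) (All.lookup normalised (C⊆L vu∈C)))
... | vs , path@(_ ∷ _ ∷ rest) , unique , |vs|≤ =
  ≤-trans (girth vs cycle) |vs|≤
  where
  cycle : IsCycle L vs
  cycle = VertexWalk-close-cycle (VertexWalk-mono C⊆L path) unique
            (s≤s (s≤s (VertexWalk-nonempty rest))) (inj₂ uv∈L)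

high-girth⇒endpoints-far : GirthAtLeast L (k + 2) → All (λ e → proj₁ e <ᶠ proj₂ e) L →
                           (u , v) ∈ L → C ⊆ L → (u , v) ∉ C → ¬ DistLE C u v k
high-girth⇒endpoints-far {k = k} girth normalised uv∈L C⊆L uv∉C (m , m≤k , walk) =
  <⇒≱ (≤-pred (subst (_≤ suc m) (+-comm k 2) k+2≤1+m)) m≤k
  where
  k+2≤1+m : k + 2 ≤ suc m
  k+2≤1+m = girth≤1+detour girth normalised uv∈L C⊆L uv∉C walk

spanner⇒edge-stretch : {G : Graph n} {H : List (Edge n)} → IsSpanner G H k →
                       (u , v) ∈ edges G → DistLE H u v k
spanner⇒edge-stretch {k = k} {u = u} {v = v} spanner uv∈G
  with m , m≤k*1 , walk ← spanner u v 1 (1 , ≤-refl , inj₁ uv∈G ∷ [])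
  = m , subst (m ≤_) (*-identityʳ k) m≤k*1 , walk

Greedy-++ : ∀ {σ τ C M out} → Greedy {n} k σ C M → Greedy k τ M out →
            Greedy k (σ ++ τ) C out
Greedy-++ done            rest = rest
Greedy-++ (add far run)   rest = add far (Greedy-++ run rest)
Greedy-++ (skip near run) rest = skip near (Greedy-++ run rest)

Greedy-skipAll : ∀ {τ} → All (λ e → DistLE C (proj₁ e) (proj₂ e) k) τ → Greedy k τ C C
Greedy-skipAll []             = done
Greedy-skipAll (near ∷ nears) = skip near (Greedy-skipAll nears)

Greedy-addAll-high-girth : ∀ {hs} → GirthAtLeast L (k + 2) →
                           All (λ e → proj₁ e <ᶠ proj₂ e) L →
                           Unique hs → hs ⊆ L → C ⊆ L → All (_∉ C) hs →
                           Greedy k hs C (hs ʳ++ C)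
Greedy-addAll-high-girth girth normalised [] _ _ [] = done
Greedy-addAll-high-girth girth normalised (e≢hs ∷ unique) hs⊆L C⊆L (e∉C ∷ hs∉C) =
  add (high-girth⇒endpoints-far girth normalised (hs⊆L (here refl)) C⊆L e∉C)
      (Greedy-addAll-high-girth girth normalised unique (hs⊆L ∘ there)
         (∈-∷⁺ʳ (hs⊆L (here refl)) C⊆L) (All.zipWith avoids (e≢hs , hs∉C)))
  where
  avoids : ∀ {e f} → e ≢ f × f ∉ C → f ∉ e ∷ C
  avoids (e≢f , f∉C) (here f≡e) = e≢f (sym f≡e)
  avoids (e≢f , f∉C) (there f∈C) = f∉C f∈C

proposition1p3 : (n : ℕ) (G : Graph n) (k : ℕ) → 1 ≤ k →
    (H : List (Edge n)) → IsSubgraph G H → IsSpanner G H k →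
    GirthAtLeast H (k + 2) →
    Σ (List (Edge n)) λ σ → (σ ↭ edges G) ×
      Σ (List (Edge n)) λ out → Greedy k σ [] out × (∀ e → (e ∈ out) ⇔ (e ∈ H))
proposition1p3 n G k _ H H⊆G spanner girth =
  inH ++ notInH , filter-++-filter-∁-↭ inH? (edges G) ,
  reverse inH , Greedy-++ addAll skipAll ,
  λ e → mk⇔ (inH⊆H ∘ reverse⁻) (reverse⁺ ∘ H⊆inH)
  where
  inH? : Decidable (_∈ H)
  inH? e = DecMembership._∈?_ _≟ᵉ_ e H

  inH notInH : List (Edge n)
  inH    = filter inH? (edges G)
  notInH = filter (∁? inH?) (edges G)

  inH⊆H : inH ⊆ H
  inH⊆H = proj₂ ∘ ∈-filter⁻ inH? {xs = edges G}

  H⊆inH : H ⊆ inH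
  H⊆inH e∈H = ∈-filter⁺ inH? (H⊆G e∈H) e∈H

  addAll : Greedy k inH [] (reverse inH)
  addAll = Greedy-addAll-high-girth girth (All.tabulate (All.lookup (normalised G) ∘ H⊆G))
             (Unique.filter⁺ inH? (distinct G)) inH⊆H (λ ()) (All.tabulate λ _ ())

  skipAll : Greedy k notInH (reverse inH) (reverse inH)
  skipAll = Greedy-skipAll (All.tabulate λ e∈notInH →
    DistLE-mono (reverse⁺ ∘ H⊆inH)
      (spanner⇒edge-stretch {G = G} spanner
        (proj₁ (∈-filter⁻ (∁? inH?) {xs = edges G} e∈notInH))))
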